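{- Let $n\ge2$ and $\beta=(\beta_1,\dotsc,\beta_n)\in\mathbb{Z}_{\ge0}^n$ with $\beta_i\le n-i$ for $2\le i\le n$. Then $$\partial^a_{n-1}\cdots\partial^a_2\partial^a_1\, a^\beta=\begin{cases}0&\text{if }\beta_1<n-1,\\ a_1^{\beta_2}a_2^{\beta_3}\cdots a_{n-1}^{\beta_n}&\text{if }\beta_1=n-1.\end{cases}$$
   Context: $a^\beta=a_1^{\beta_1}\cdots a_n^{\beta_n}$ in the polynomial ring $\mathbb{Z}[a_1,\dotsc,a_n]$. $\partial_i^af=(f-s_i^af)/(a_i-a_{i+1})$, where $s_i^a$ exchanges $a_i$ and $a_{i+1}$; operators compose right-to-left, so $\partial^a_1$ is applied first. -}

module Defs where

open import Data.Nat as ℕ using (ℕ; zero; suc)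
open import Data.Integer as ℤ using (ℤ)
open import Data.Vec using (Vec; []; _∷_; zipWith; replicate)
open import Data.Vec.Properties using (≡-dec)
open import Data.List using (List; []; _∷_; _++_; map; concatMap)
open import Data.Product using (_×_; _,_)
open import Relation.Nullary using (yes; no)
open import Relation.Binary.PropositionalEquality using (_≡_)

-- Polynomials in ℤ[a_1,…,a_n] as finite formal sums of terms c·a^e,
-- with e : Vec ℕ n an exponent vector (position j, 0-based, is the exponent of a_{j+1}).
Poly : ℕ → Set
Poly n = List (ℤ × Vec ℕ n)

coeff : ∀ {n} → Poly n → Vec ℕ n → ℤ
coeff [] e = ℤ.0ℤ
coeff ((c , d) ∷ f) e with ≡-dec ℕ._≟_ d e
... | yes _ = c ℤ.+ coeff f e
... | no  _ = coeff f e

infix 4 _≈_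
_≈_ : ∀ {n} → Poly n → Poly n → Set
f ≈ g = ∀ e → coeff f e ≡ coeff g e

mono : ∀ {n} → Vec ℕ n → Poly n
mono β = (ℤ.1ℤ , β) ∷ []

0P : ∀ {n} → Poly n
0P = []

infixl 6 _+P_ _-P_
infixl 7 _*P_

_+P_ : ∀ {n} → Poly n → Poly n → Poly n
f +P g = f ++ g

-P_ : ∀ {n} → Poly n → Poly n
-P f = map (λ { (c , e) → (ℤ.- c , e) }) f

_-P_ : ∀ {n} → Poly n → Poly n → Poly n
f -P g = f +P (-P g)

_*P_ : ∀ {n} → Poly n → Poly n → Poly n
f *P g = concatMap (λ { (c , d) → map (λ { (c' , d') → (c ℤ.* c' , zipWith ℕ._+_ d d') }) g }) f

unitExp : ∀ {n} → ℕ → Vec ℕ n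
unitExp {zero} _ = []
unitExp {suc n} zero = 1 ∷ replicate n 0
unitExp {suc n} (suc j) = 0 ∷ unitExp {n} j

-- the variable a_{j+1} (0-based index j)
var : ∀ {n} → ℕ → Poly n
var j = mono (unitExp j)

swapExp : ∀ {n} → ℕ → Vec ℕ n → Vec ℕ n
swapExp zero (x ∷ y ∷ xs) = y ∷ x ∷ xs
swapExp (suc j) (x ∷ xs) = x ∷ swapExp j xs
swapExp _ v = v

-- s_{j+1}: exchanges a_{j+1} and a_{j+2} (0-based j)
swapP : ∀ {n} → ℕ → Poly n → Poly n
swapP j f = map (λ { (c , e) → (c , swapExp j e) }) f

-- IsDivDiff j f g : g = ∂_{j+1} f, i.e. (a_{j+1} - a_{j+2}) · g = f - s_{j+1} f.
-- (Since ℤ[a] is a domain, this determines g uniquely.)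
IsDivDiff : ∀ {n} → ℕ → Poly n → Poly n → Set
IsDivDiff j f g = (var j -P var (suc j)) *P g ≈ f -P swapP j f

-- A chain g with g 0 = f and g (k+1) = ∂_{k+1} (g k) for k < len,
-- so that g len = ∂_len ⋯ ∂_2 ∂_1 f.
IsDivDiffChain : ∀ {n} → ℕ → Poly n → (ℕ → Poly n) → Set
IsDivDiffChain {n} len f g = (g 0 ≈ f) × (∀ k → k ℕ.< len → IsDivDiff k (g k) (g (suc k)))

module Submission where

open import Defs
open import Level using (Level)
open import Function using (_∘_)
open import Data.Empty using (⊥)
open import Data.Unit using (⊤; tt)
open import Data.Sum using (_⊎_; inj₁; inj₂)
open import Data.Product using (_×_; Σ; _,_; proj₁; proj₂)
open import Data.Nat as ℕ using (ℕ; zero; suc; z≤n; s≤s; _≤_; _<_; _∸_)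
import Data.Nat.Properties as ℕP
open import Data.Integer using (ℤ; 0ℤ; 1ℤ; _+_; _*_; -_; _-_)
import Data.Integer.Properties as ℤP
open import Data.Integer.Tactic.RingSolver using (solve-∀)
open import Algebra.Properties.AbelianGroup ℤP.+-0-abelianGroup using () renaming (∙-cancelʳ to +-cancelʳ)
open import Data.Fin as Fin using (Fin; toℕ)
open import Data.Vec using (Vec; []; _∷_; lookup; _∷ʳ_; zipWith; replicate)
open import Data.Vec.Properties using (≡-dec; ∷-injectiveˡ; ∷-injectiveʳ; zipWith-identityˡ)
open import Data.List using ([]; _∷_; _++_)
open import Data.List.Properties using (concatMap-++)
open import Relation.Nullary using (Dec; yes; no; ¬_)
open import Relation.Nullary.Negation using (contradiction)
open import Relation.Binary.Definitions using (tri<; tri≈; tri>)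
open import Relation.Binary.PropositionalEquality
  using (_≡_; _≢_; refl; sym; trans; cong; cong₂; ≢-sym; module ≡-Reasoning)

-- All identities are proved coefficientwise: a polynomial is replaced by its coefficient function
-- ℕⁿ → ℤ, multiplication by a_{j+1} becomes a shift of exponents, and g = ∂_{j+1} f becomes the
-- identity (a_{j+1} − a_{j+2})·g = f − s_{j+1} f between coefficient functions.  Since
-- a_{j+1} − a_{j+2} is not a zero divisor, this identity determines g; that some g exists is shown
-- by an explicit construction, monomial by monomial.
--
-- For a monomial, ∂₁(a₁ᵇ a₂ᶜ aʳ) = Σ_{x+y+1 = b+c} ([x < b] − [x < c]) a₁ˣ a₂ʸ aʳ.  The operators
-- ∂₂, …, ∂_{n−1} do not involve a₁, so on the a₁ˣ-part the rest of the chain is the chain of the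
-- monomial a₂^{b+c−1−x} aʳ in one variable fewer, scaled by [x < b] − [x < c]; induction on n
-- applies to it.  Under the staircase bounds this scalar vanishes unless b+c−1−x ≤ n−2, and the
-- top exponent n−2 is reached only for b = n−1 and x = c.

private
  variable
    ℓ ℓ′ ℓ″ : Level
    P : Set ℓ
    Q : Set ℓ′
    R : Set ℓ″

[_] : Dec P → ℤ
[ yes _ ] = 1ℤ
[ no _ ] = 0ℤ

[]-yes : (dP : Dec P) → P → [ dP ] ≡ 1ℤ
[]-yes (yes _) _ = refl
[]-yes (no ¬p) p = contradiction p ¬p

[]-no : (dP : Dec P) → ¬ P → [ dP ] ≡ 0ℤ
[]-no (yes p) ¬p = contradiction p ¬p
[]-no (no _) _ = refl

[]-resp : (dP : Dec P) (dQ : Dec Q) → (P → Q) → (Q → P) → [ dP ] ≡ [ dQ ]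
[]-resp dP (yes q) _ Q→P = []-yes dP (Q→P q)
[]-resp dP (no ¬q) P→Q _ = []-no dP (¬q ∘ P→Q)

[]-*-resp : (dP : Dec P) (dQ : Dec Q) (dR : Dec R) →
  (P → Q → R) → (P → R → Q) → [ dP ] * [ dQ ] ≡ [ dP ] * [ dR ]
[]-*-resp (yes p) dQ dR f g = cong (1ℤ *_) ([]-resp dQ dR (f p) (g p))
[]-*-resp (no _) _ _ _ _ = refl

[]-× : (dP : Dec P) (dQ : Dec Q) (dR : Dec R) →
  (P → Q → R) → (R → P) → (R → Q) → [ dP ] * [ dQ ] ≡ [ dR ]
[]-× (yes p) (yes q) dR f _ _ = sym ([]-yes dR (f p q))
[]-× (yes _) (no ¬q) dR _ _ g = sym ([]-no dR (¬q ∘ g))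
[]-× (no ¬p) _ dR _ g _ = sym ([]-no dR (¬p ∘ g))

[]-*-disjoint : (dP : Dec P) (dQ : Dec Q) → (P → Q → ⊥) → [ dP ] * [ dQ ] ≡ 0ℤ
[]-*-disjoint (yes p) (yes q) ¬pq = contradiction q (¬pq p)
[]-*-disjoint (yes _) (no _) _ = refl
[]-*-disjoint (no _) _ _ = refl

[]-absorb : (dP : Dec P) {a : ℤ} → (¬ P → a ≡ 0ℤ) → [ dP ] * a ≡ a
[]-absorb (yes _) _ = ℤP.*-identityˡ _
[]-absorb (no ¬p) a≡0 = sym (a≡0 ¬p)

[]-annihilate : (dP : Dec P) {a : ℤ} → (P → a ≡ 0ℤ) → a * [ dP ] ≡ 0ℤ
[]-annihilate (yes p) {a} a≡0 = trans (ℤP.*-identityʳ a) (a≡0 p)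
[]-annihilate (no _) {a} _ = ℤP.*-zeroʳ a

[≟]-subst : ∀ {A : Set} {t x : A} (d : Dec (t ≡ x)) (T : A → ℤ) → [ d ] * T t ≡ [ d ] * T x
[≟]-subst (yes refl) T = refl
[≟]-subst (no _) T = refl

[≤]-[<] : ∀ x b → [ x ℕ.≤? b ] - [ x ℕ.<? b ] ≡ [ b ℕ.≟ x ]
[≤]-[<] x b with ℕP.<-cmp b x
... | tri< b<x _ _ =
  trans (cong₂ _-_ ([]-no (x ℕ.≤? b) (ℕP.<⇒≱ b<x)) ([]-no (x ℕ.<? b) (ℕP.<⇒≯ b<x)))
                           (sym ([]-no (b ℕ.≟ x) (ℕP.<⇒≢ b<x)))
... | tri≈ _ refl _ = trans (cong₂ _-_ ([]-yes (b ℕ.≤? b) ℕP.≤-refl) ([]-no (b ℕ.<? b) (ℕP.n≮n b)))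
                            (sym ([]-yes (b ℕ.≟ b) refl))
... | tri> _ _ x<b = trans (cong₂ _-_ ([]-yes (x ℕ.≤? b) (ℕP.<⇒≤ x<b)) ([]-yes (x ℕ.<? b) x<b))
                           (sym ([]-no (b ℕ.≟ x) (≢-sym (ℕP.<⇒≢ x<b))))

[≟]+[<] : ∀ t x → [ t ℕ.≟ x ] + [ x ℕ.<? t ] ≡ [ x ℕ.<? suc t ]
[≟]+[<] t x with ℕP.<-cmp x t
... | tri< x<t _ _ = trans (cong₂ _+_ ([]-no (t ℕ.≟ x) (≢-sym (ℕP.<⇒≢ x<t))) ([]-yes (x ℕ.<? t) x<t))
                           (sym ([]-yes (x ℕ.<? suc t) (ℕP.m≤n⇒m≤1+n x<t)))
... | tri≈ _ refl _ = trans (cong₂ _+_ ([]-yes (x ℕ.≟ x) refl) ([]-no (x ℕ.<? x) (ℕP.n≮n x)))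
                            (sym ([]-yes (x ℕ.<? suc x) (ℕP.n<1+n x)))
... | tri> _ _ t<x =
  trans (cong₂ _+_ ([]-no (t ℕ.≟ x) (ℕP.<⇒≢ t<x)) ([]-no (x ℕ.<? t) (ℕP.<⇒≯ t<x)))
                           (sym ([]-no (x ℕ.<? suc t) (ℕP.≤⇒≯ t<x)))

Coeffs : ℕ → Set
Coeffs n = Vec ℕ n → ℤ

infix 4 _≐_
_≐_ : ∀ {n} → Coeffs n → Coeffs n → Set
F ≐ G = ∀ e → F e ≡ G e

0ᶜ : ∀ {n} → Coeffs n
0ᶜ _ = 0ℤ

_≟ᵥ_ : ∀ {n} (d e : Vec ℕ n) → Dec (d ≡ e)
_≟ᵥ_ = ≡-dec ℕ._≟_

δ : ∀ {n} → Vec ℕ n → Coeffs n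
δ d e = [ d ≟ᵥ e ]

prefixᶜ : ∀ {n} → ℕ → Coeffs n → Coeffs (suc n)
prefixᶜ x F (y ∷ e) = [ x ℕ.≟ y ] * F e

δ-∷ : ∀ {n} x (d : Vec ℕ n) → δ (x ∷ d) ≐ prefixᶜ x (δ d)
δ-∷ x d (y ∷ e) =
  sym ([]-× (x ℕ.≟ y) (d ≟ᵥ e) ((x ∷ d) ≟ᵥ (y ∷ e)) (cong₂ _∷_) ∷-injectiveˡ ∷-injectiveʳ)

swapExp-involutive : ∀ {n} j (v : Vec ℕ n) → swapExp j (swapExp j v) ≡ v
swapExp-involutive zero [] = refl
swapExp-involutive zero (x ∷ []) = refl
swapExp-involutive zero (x ∷ y ∷ v) = refl
swapExp-involutive (suc j) [] = refl
swapExp-involutive (suc j) (x ∷ v) = cong (x ∷_) (swapExp-involutive j v)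

δ-swapExp : ∀ {n} j (d e : Vec ℕ n) → δ (swapExp j d) e ≡ δ d (swapExp j e)
δ-swapExp j d e = []-resp (swapExp j d ≟ᵥ e) (d ≟ᵥ swapExp j e)
  (λ { refl → sym (swapExp-involutive j d) })
  (λ { refl → swapExp-involutive j e })

coeff-∷ : ∀ {n} c (d : Vec ℕ n) f e → coeff ((c , d) ∷ f) e ≡ c * δ d e + coeff f e
coeff-∷ c d f e with ≡-dec ℕ._≟_ d e
... | yes _ = cong (_+ coeff f e) (sym (ℤP.*-identityʳ c))
... | no _ = sym (trans (cong (_+ coeff f e) (ℤP.*-zeroʳ c)) (ℤP.+-identityˡ _))

coeff-mono : ∀ {n} (d : Vec ℕ n) → coeff (mono d) ≐ δ d
coeff-mono d e with ≡-dec ℕ._≟_ d e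
... | yes _ = refl
... | no _ = refl

coeff-++ : ∀ {n} (f g : Poly n) e → coeff (f ++ g) e ≡ coeff f e + coeff g e
coeff-++ [] g e = sym (ℤP.+-identityˡ _)
coeff-++ ((c , d) ∷ f) g e = begin
  coeff ((c , d) ∷ f ++ g) e               ≡⟨ coeff-∷ c d (f ++ g) e ⟩
  c * δ d e + coeff (f ++ g) e             ≡⟨ cong (c * δ d e +_) (coeff-++ f g e) ⟩
  c * δ d e + (coeff f e + coeff g e)      ≡⟨ sym (ℤP.+-assoc (c * δ d e) _ _) ⟩
  (c * δ d e + coeff f e) + coeff g e      ≡⟨ cong (_+ coeff g e) (sym (coeff-∷ c d f e)) ⟩
  coeff ((c , d) ∷ f) e + coeff g e        ∎
  where open ≡-Reasoning

coeff-negP : ∀ {n} (f : Poly n) e → coeff (-P f) e ≡ - coeff f e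
coeff-negP [] e = refl
coeff-negP ((c , d) ∷ f) e = begin
  coeff ((- c , d) ∷ -P f) e         ≡⟨ coeff-∷ (- c) d (-P f) e ⟩
  - c * δ d e + coeff (-P f) e       ≡⟨ cong₂ _+_ (sym (ℤP.neg-distribˡ-* c (δ d e))) (coeff-negP f e) ⟩
  - (c * δ d e) + - coeff f e        ≡⟨ sym (ℤP.neg-distrib-+ (c * δ d e) (coeff f e)) ⟩
  - (c * δ d e + coeff f e)          ≡⟨ cong -_ (sym (coeff-∷ c d f e)) ⟩
  - coeff ((c , d) ∷ f) e            ∎
  where open ≡-Reasoning

coeff-swapP : ∀ {n} j (f : Poly n) e → coeff (swapP j f) e ≡ coeff f (swapExp j e)
coeff-swapP j [] e = refl
coeff-swapP j ((c , d) ∷ f) e = begin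
  coeff ((c , swapExp j d) ∷ swapP j f) e
    ≡⟨ coeff-∷ c (swapExp j d) (swapP j f) e ⟩
  c * δ (swapExp j d) e + coeff (swapP j f) e
    ≡⟨ cong₂ (λ u v → c * u + v) (δ-swapExp j d e) (coeff-swapP j f e) ⟩
  c * δ d (swapExp j e) + coeff f (swapExp j e)
    ≡⟨ sym (coeff-∷ c d f (swapExp j e)) ⟩
  coeff ((c , d) ∷ f) (swapExp j e) ∎
  where open ≡-Reasoning

-- Divided differences, coefficientwise

-- Coefficients of a_{j+1} · G; for j ≥ n, unitExp j is the zero vector and var j is the constant 1.
mulVar : ∀ {n} → ℕ → Coeffs n → Coeffs n
mulVar _ G [] = G []
mulVar zero G (zero ∷ e) = 0ℤ
mulVar zero G (suc x ∷ e) = G (x ∷ e)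
mulVar (suc j) G (x ∷ e) = mulVar j (λ e′ → G (x ∷ e′)) e

mulVar-cong : ∀ {n} j {F G : Coeffs n} → F ≐ G → mulVar j F ≐ mulVar j G
mulVar-cong j F≐G [] = F≐G []
mulVar-cong zero F≐G (zero ∷ e) = refl
mulVar-cong zero F≐G (suc x ∷ e) = F≐G (x ∷ e)
mulVar-cong (suc j) F≐G (x ∷ e) = mulVar-cong j (λ e′ → F≐G (x ∷ e′)) e

mulVar-map₂ : ∀ {n} j (h : ℤ → ℤ → ℤ) → h 0ℤ 0ℤ ≡ 0ℤ → (F G : Coeffs n) →
  mulVar j (λ e → h (F e) (G e)) ≐ λ e → h (mulVar j F e) (mulVar j G e)
mulVar-map₂ j h h00 F G [] = refl
mulVar-map₂ zero h h00 F G (zero ∷ e) = sym h00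
mulVar-map₂ zero h h00 F G (suc x ∷ e) = refl
mulVar-map₂ (suc j) h h00 F G (x ∷ e) =
  mulVar-map₂ j h h00 (λ e′ → F (x ∷ e′)) (λ e′ → G (x ∷ e′)) e

mulVar-0 : ∀ {n} j → mulVar {n} j 0ᶜ ≐ 0ᶜ
mulVar-0 j = mulVar-map₂ j (λ _ _ → 0ℤ) refl 0ᶜ 0ᶜ

mulVar-δ : ∀ {n} j (d : Vec ℕ n) → mulVar j (δ d) ≐ δ (zipWith ℕ._+_ (unitExp j) d)
mulVar-δ j [] [] = refl
mulVar-δ zero (x ∷ d) (zero ∷ e) =
  sym ([]-no ((suc x ∷ zipWith ℕ._+_ (replicate _ 0) d) ≟ᵥ (zero ∷ e)) (λ ()))
mulVar-δ zero (x ∷ d) (suc y ∷ e) = trans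
  ([]-resp ((x ∷ d) ≟ᵥ (y ∷ e)) ((suc x ∷ d) ≟ᵥ (suc y ∷ e)) (cong (λ { (z ∷ v) → suc z ∷ v }))
    (λ eq → cong₂ _∷_ (ℕP.suc-injective (∷-injectiveˡ eq)) (∷-injectiveʳ eq)))
  (cong (λ v → δ (suc x ∷ v) (suc y ∷ e)) (sym (zipWith-identityˡ ℕP.+-identityˡ d)))
mulVar-δ (suc j) (x ∷ d) (y ∷ e) = begin
  mulVar j (λ e′ → δ (x ∷ d) (y ∷ e′)) e
    ≡⟨ mulVar-cong j (λ e′ → δ-∷ x d (y ∷ e′)) e ⟩
  mulVar j (λ e′ → [ x ℕ.≟ y ] * δ d e′) e
    ≡⟨ mulVar-map₂ j (λ u _ → [ x ℕ.≟ y ] * u) (ℤP.*-zeroʳ [ x ℕ.≟ y ]) (δ d) (δ d) e ⟩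
  [ x ℕ.≟ y ] * mulVar j (δ d) e
    ≡⟨ cong ([ x ℕ.≟ y ] *_) (mulVar-δ j d e) ⟩
  [ x ℕ.≟ y ] * δ (zipWith ℕ._+_ (unitExp j) d) e
    ≡⟨ sym (δ-∷ x _ (y ∷ e)) ⟩
  δ (x ∷ zipWith ℕ._+_ (unitExp j) d) (y ∷ e) ∎
  where open ≡-Reasoning

mulVar-coeff-∷ : ∀ {n} j c (d : Vec ℕ n) f e →
  mulVar j (coeff ((c , d) ∷ f)) e ≡ c * mulVar j (δ d) e + mulVar j (coeff f) e
mulVar-coeff-∷ j c d f e = trans (mulVar-cong j (coeff-∷ c d f) e)
  (mulVar-map₂ j (λ u v → c * u + v) (trans (ℤP.+-identityʳ _) (ℤP.*-zeroʳ c)) (δ d) (coeff f) e)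

coeff-monomial-*P : ∀ {n} j k (g : Poly n) e →
  coeff (((k , unitExp j) ∷ []) *P g) e ≡ k * mulVar j (coeff g) e
coeff-monomial-*P j k [] e = sym (trans (cong (k *_) (mulVar-0 j e)) (ℤP.*-zeroʳ k))
coeff-monomial-*P j k ((c , d) ∷ g) e = begin
  coeff ((k * c , zipWith ℕ._+_ (unitExp j) d) ∷ ((k , unitExp j) ∷ []) *P g) e
    ≡⟨ coeff-∷ (k * c) _ _ e ⟩
  k * c * δ (zipWith ℕ._+_ (unitExp j) d) e + coeff (((k , unitExp j) ∷ []) *P g) e
    ≡⟨ cong₂ (λ u v → k * c * u + v) (sym (mulVar-δ j d e)) (coeff-monomial-*P j k g e) ⟩
  k * c * mulVar j (δ d) e + k * mulVar j (coeff g) e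
    ≡⟨ distrib k c _ _ ⟩
  k * (c * mulVar j (δ d) e + mulVar j (coeff g) e)
    ≡⟨ cong (k *_) (sym (mulVar-coeff-∷ j c d g e)) ⟩
  k * mulVar j (coeff ((c , d) ∷ g)) e ∎
  where
  open ≡-Reasoning
  distrib : ∀ k c u v → k * c * u + k * v ≡ k * (c * u + v)
  distrib = solve-∀

mulDiff : ∀ {n} → ℕ → Coeffs n → Coeffs n
mulDiff j G e = mulVar j G e - mulVar (suc j) G e

swapDiff : ∀ {n} → ℕ → Coeffs n → Coeffs n
swapDiff j F e = F e - F (swapExp j e)

*P-distribʳ-++ : ∀ {n} (f g h : Poly n) → (f ++ g) *P h ≡ f *P h ++ g *P h
*P-distribʳ-++ f g h = concatMap-++ _ f g

coeff-mulDiff : ∀ {n} j (g : Poly n) → coeff ((var j -P var (suc j)) *P g) ≐ mulDiff j (coeff g)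
coeff-mulDiff j g e = begin
  coeff ((var j -P var (suc j)) *P g) e
    ≡⟨ cong (λ h → coeff h e) (*P-distribʳ-++ (var j) (-P var (suc j)) g) ⟩
  coeff ((var j *P g) ++ ((-P var (suc j)) *P g)) e
    ≡⟨ coeff-++ (var j *P g) _ e ⟩
  coeff (var j *P g) e + coeff ((-P var (suc j)) *P g) e
    ≡⟨ cong₂ _+_ (coeff-monomial-*P j 1ℤ g e) (coeff-monomial-*P (suc j) (- 1ℤ) g e) ⟩
  1ℤ * mulVar j (coeff g) e + - 1ℤ * mulVar (suc j) (coeff g) e
    ≡⟨ unit-combination (mulVar j (coeff g) e) (mulVar (suc j) (coeff g) e) ⟩
  mulDiff j (coeff g) e ∎
  where
  open ≡-Reasoning
  unit-combination : ∀ u v → 1ℤ * u + - 1ℤ * v ≡ u - v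
  unit-combination = solve-∀

coeff-swapDiff : ∀ {n} j (f : Poly n) → coeff (f -P swapP j f) ≐ swapDiff j (coeff f)
coeff-swapDiff j f e = trans (coeff-++ f _ e)
  (cong (coeff f e +_) (trans (coeff-negP (swapP j f) e) (cong -_ (coeff-swapP j f e))))

record IsDivDiffᶜ {n} (j : ℕ) (F G : Coeffs n) : Set where
  constructor isDivDiffᶜ
  field mulDiff≐swapDiff : mulDiff j G ≐ swapDiff j F

open IsDivDiffᶜ

IsDivDiff⇒IsDivDiffᶜ : ∀ {n} j (f g : Poly n) → IsDivDiff j f g → IsDivDiffᶜ j (coeff f) (coeff g)
IsDivDiff⇒IsDivDiffᶜ j f g ∂f≡g = isDivDiffᶜ λ e →
  trans (sym (coeff-mulDiff j g e)) (trans (∂f≡g e) (coeff-swapDiff j f e))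

IsDivDiffᶜ⇒IsDivDiff : ∀ {n} j (f g : Poly n) → IsDivDiffᶜ j (coeff f) (coeff g) → IsDivDiff j f g
IsDivDiffᶜ⇒IsDivDiff j f g (isDivDiffᶜ ∂f≡g) e =
  trans (coeff-mulDiff j g e) (trans (∂f≡g e) (sym (coeff-swapDiff j f e)))

IsDivDiffᶜ-resp : ∀ {n} j {F F′ G G′ : Coeffs n} →
  F ≐ F′ → G ≐ G′ → IsDivDiffᶜ j F G → IsDivDiffᶜ j F′ G′
IsDivDiffᶜ-resp j F≐F′ G≐G′ (isDivDiffᶜ ∂F≐G) = isDivDiffᶜ λ e →
  trans (sym (cong₂ _-_ (mulVar-cong j G≐G′ e) (mulVar-cong (suc j) G≐G′ e)))
    (trans (∂F≐G e) (cong₂ _-_ (F≐F′ e) (F≐F′ (swapExp j e))))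

IsDivDiffᶜ-+ : ∀ {n} j {F F′ G G′ : Coeffs n} → IsDivDiffᶜ j F G → IsDivDiffᶜ j F′ G′ →
  IsDivDiffᶜ j (λ e → F e + F′ e) (λ e → G e + G′ e)
IsDivDiffᶜ-+ j {F} {F′} {G} {G′} (isDivDiffᶜ ∂F≐G) (isDivDiffᶜ ∂F′≐G′) =
  isDivDiffᶜ λ e → begin
  mulVar j (λ e → G e + G′ e) e - mulVar (suc j) (λ e → G e + G′ e) e
    ≡⟨ cong₂ _-_ (mulVar-map₂ j _+_ refl G G′ e) (mulVar-map₂ (suc j) _+_ refl G G′ e) ⟩
  (mulVar j G e + mulVar j G′ e) - (mulVar (suc j) G e + mulVar (suc j) G′ e)
    ≡⟨ interchange (mulVar j G e) (mulVar j G′ e) (mulVar (suc j) G e) (mulVar (suc j) G′ e) ⟩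
  mulDiff j G e + mulDiff j G′ e
    ≡⟨ cong₂ _+_ (∂F≐G e) (∂F′≐G′ e) ⟩
  swapDiff j F e + swapDiff j F′ e
    ≡⟨ sym (interchange (F e) (F′ e) (F (swapExp j e)) (F′ (swapExp j e))) ⟩
  (F e + F′ e) - (F (swapExp j e) + F′ (swapExp j e)) ∎
  where
  open ≡-Reasoning
  interchange : ∀ a b c d → (a + b) - (c + d) ≡ (a - c) + (b - d)
  interchange = solve-∀

IsDivDiffᶜ-scale : ∀ {n} j k {F G : Coeffs n} → IsDivDiffᶜ j F G →
  IsDivDiffᶜ j (λ e → k * F e) (λ e → k * G e)
IsDivDiffᶜ-scale j k {F} {G} (isDivDiffᶜ ∂F≐G) = isDivDiffᶜ λ e → begin
  mulVar j (λ e → k * G e) e - mulVar (suc j) (λ e → k * G e) e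
    ≡⟨ cong₂ _-_ (mulVar-map₂ j (λ u _ → k * u) (ℤP.*-zeroʳ k) G G e)
                 (mulVar-map₂ (suc j) (λ u _ → k * u) (ℤP.*-zeroʳ k) G G e) ⟩
  k * mulVar j G e - k * mulVar (suc j) G e
    ≡⟨ distrib k _ _ ⟩
  k * mulDiff j G e
    ≡⟨ cong (k *_) (∂F≐G e) ⟩
  k * swapDiff j F e
    ≡⟨ sym (distrib k _ _) ⟩
  k * F e - k * F (swapExp j e) ∎
  where
  open ≡-Reasoning
  distrib : ∀ k a b → k * a - k * b ≡ k * (a - b)
  distrib = solve-∀

IsDivDiffᶜ-0 : ∀ {n} j → IsDivDiffᶜ {n} j 0ᶜ 0ᶜ
IsDivDiffᶜ-0 j = isDivDiffᶜ λ e → cong₂ _-_ (mulVar-0 j e) (mulVar-0 (suc j) e)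

IsDivDiffᶜ-swapInvariant : ∀ {n} j (F : Coeffs n) → (∀ e → swapExp j e ≡ e) → IsDivDiffᶜ j F 0ᶜ
IsDivDiffᶜ-swapInvariant j F swap≡id = isDivDiffᶜ λ e → trans (mulDiff≐swapDiff (IsDivDiffᶜ-0 j) e)
  (sym (trans (cong (λ v → F e - F v) (swap≡id e)) (ℤP.+-inverseʳ (F e))))

IsDivDiffᶜ-prefix : ∀ {n} j x {F G : Coeffs n} → IsDivDiffᶜ j F G →
  IsDivDiffᶜ (suc j) (prefixᶜ x F) (prefixᶜ x G)
IsDivDiffᶜ-prefix j x ∂F≐G =
  isDivDiffᶜ λ { (y ∷ e) → mulDiff≐swapDiff (IsDivDiffᶜ-scale j [ x ℕ.≟ y ] ∂F≐G) e }

-- The coefficient of a₁^{x+1} a₂^y in (a₁ − a₂)·G is G(x, y) − G(x+1, y−1); induct on y.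
mulDiff-injective : ∀ {n} j → suc j < n → {G G′ : Coeffs n} → mulDiff j G ≐ mulDiff j G′ → G ≐ G′
mulDiff-injective zero (s≤s (s≤s z≤n)) {G} {G′} eq (x ∷ y ∷ r) = by-exponent y x
  where
  by-exponent : ∀ y x → G (x ∷ y ∷ r) ≡ G′ (x ∷ y ∷ r)
  by-exponent zero x = +-cancelʳ 0ℤ _ _ (eq (suc x ∷ zero ∷ r))
  by-exponent (suc y) x = +-cancelʳ (- G (suc x ∷ y ∷ r)) _ _
    (trans (eq (suc x ∷ suc y ∷ r)) (cong (λ z → G′ (x ∷ suc y ∷ r) - z) (sym (by-exponent y (suc x)))))
mulDiff-injective (suc j) (s≤s j<n) eq (x ∷ e) = mulDiff-injective j j<n (λ e′ → eq (x ∷ e′)) e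

IsDivDiffᶜ-unique : ∀ {n} j → suc j < n → {F G G′ : Coeffs n} →
  IsDivDiffᶜ j F G → IsDivDiffᶜ j F G′ → G ≐ G′
IsDivDiffᶜ-unique j j<n (isDivDiffᶜ ∂F≐G) (isDivDiffᶜ ∂F≐G′) =
  mulDiff-injective j j<n (λ e → trans (∂F≐G e) (sym (∂F≐G′ e)))

-- ∂₁ of a monomial

-- ∂₁ (a₁ᵇ a₂ᶜ) = Σ_{x + y + 1 = b + c} φ b c x · a₁ˣ a₂ʸ.
φ : ℕ → ℕ → ℕ → ℤ
φ b c x = [ x ℕ.<? b ] - [ x ℕ.<? c ]

φ-vanish : ∀ b c {x} → b ℕ.+ c ≤ x → φ b c x ≡ 0ℤ
φ-vanish b c {x} b+c≤x = cong₂ _-_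
  ([]-no (x ℕ.<? b) (ℕP.≤⇒≯ (ℕP.≤-trans (ℕP.m≤m+n b c) b+c≤x)))
  ([]-no (x ℕ.<? c) (ℕP.≤⇒≯ (ℕP.≤-trans (ℕP.m≤n+m c b) b+c≤x)))

∂₁ᶜ : ∀ {n} → ℕ → ℕ → Vec ℕ n → Coeffs (suc (suc n))
∂₁ᶜ b c r (x ∷ y ∷ r′) = φ b c x * [ suc (x ℕ.+ y) ℕ.≟ b ℕ.+ c ] * δ r r′

δ-pair : ∀ {n} b c (r : Vec ℕ n) x y r′ →
  δ (b ∷ c ∷ r) (x ∷ y ∷ r′) ≡ [ b ℕ.≟ x ] * [ c ℕ.≟ y ] * δ r r′
δ-pair b c r x y r′ = trans (δ-∷ b (c ∷ r) (x ∷ y ∷ r′))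
  (trans (cong ([ b ℕ.≟ x ] *_) (δ-∷ c r (y ∷ r′))) (sym (ℤP.*-assoc [ b ℕ.≟ x ] _ _)))

mulVar₀-∂₁ᶜ : ∀ {n} b c (r : Vec ℕ n) x y r′ → mulVar 0 (∂₁ᶜ b c r) (x ∷ y ∷ r′)
  ≡ ([ x ℕ.≤? b ] - [ x ℕ.≤? c ]) * [ x ℕ.+ y ℕ.≟ b ℕ.+ c ] * δ r r′
mulVar₀-∂₁ᶜ b c r zero y r′ = refl
mulVar₀-∂₁ᶜ b c r (suc x) y r′ = refl

mulVar₁-∂₁ᶜ : ∀ {n} b c (r : Vec ℕ n) x y r′ → mulVar 1 (∂₁ᶜ b c r) (x ∷ y ∷ r′)
  ≡ φ b c x * [ x ℕ.+ y ℕ.≟ b ℕ.+ c ] * δ r r′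
mulVar₁-∂₁ᶜ b c r x zero r′ = sym (cong (_* δ r r′) ([]-annihilate (x ℕ.+ 0 ℕ.≟ b ℕ.+ c)
  (λ eq → φ-vanish b c (ℕP.≤-reflexive (trans (sym eq) (ℕP.+-identityʳ x))))))
mulVar₁-∂₁ᶜ b c r x (suc y) r′ = cong (λ z → φ b c x * z * δ r r′)
  ([]-resp (suc (x ℕ.+ y) ℕ.≟ b ℕ.+ c) (x ℕ.+ suc y ℕ.≟ b ℕ.+ c)
    (trans (ℕP.+-suc x y)) (trans (sym (ℕP.+-suc x y))))

δ-by-sum : ∀ {n} b c (r : Vec ℕ n) x y r′ →
  δ (b ∷ c ∷ r) (x ∷ y ∷ r′) ≡ [ b ℕ.≟ x ] * [ x ℕ.+ y ℕ.≟ b ℕ.+ c ] * δ r r′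
δ-by-sum b c r x y r′ = trans (δ-pair b c r x y r′) (cong (_* δ r r′)
  ([]-*-resp (b ℕ.≟ x) (c ℕ.≟ y) (x ℕ.+ y ℕ.≟ b ℕ.+ c)
    (λ { refl refl → refl }) (λ { refl eq → sym (ℕP.+-cancelˡ-≡ b y c eq) })))

δ-swapped-by-sum : ∀ {n} b c (r : Vec ℕ n) x y r′ →
  δ (b ∷ c ∷ r) (y ∷ x ∷ r′) ≡ [ c ℕ.≟ x ] * [ x ℕ.+ y ℕ.≟ b ℕ.+ c ] * δ r r′
δ-swapped-by-sum b c r x y r′ = trans (δ-pair b c r y x r′) (cong (_* δ r r′)
  (trans (ℤP.*-comm [ b ℕ.≟ y ] _)
    ([]-*-resp (c ℕ.≟ x) (b ℕ.≟ y) (x ℕ.+ y ℕ.≟ b ℕ.+ c)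
      (λ { refl refl → ℕP.+-comm c b })
      (λ { refl eq → sym (ℕP.+-cancelˡ-≡ c y b (trans eq (ℕP.+-comm b c))) }))))

∂₁ᶜ-isDivDiffᶜ : ∀ {n} b c (r : Vec ℕ n) → IsDivDiffᶜ 0 (δ (b ∷ c ∷ r)) (∂₁ᶜ b c r)
∂₁ᶜ-isDivDiffᶜ b c r = isDivDiffᶜ equation
  where
  equation : mulDiff 0 (∂₁ᶜ b c r) ≐ swapDiff 0 (δ (b ∷ c ∷ r))
  equation (x ∷ y ∷ r′) = begin
    mulVar 0 (∂₁ᶜ b c r) (x ∷ y ∷ r′) - mulVar 1 (∂₁ᶜ b c r) (x ∷ y ∷ r′)
      ≡⟨ cong₂ _-_ (mulVar₀-∂₁ᶜ b c r x y r′) (mulVar₁-∂₁ᶜ b c r x y r′) ⟩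
    ([ x ℕ.≤? b ] - [ x ℕ.≤? c ]) * D * Δ - ([ x ℕ.<? b ] - [ x ℕ.<? c ]) * D * Δ
      ≡⟨ regroup [ x ℕ.≤? b ] [ x ℕ.≤? c ] [ x ℕ.<? b ] [ x ℕ.<? c ] D Δ ⟩
    ([ x ℕ.≤? b ] - [ x ℕ.<? b ]) * D * Δ - ([ x ℕ.≤? c ] - [ x ℕ.<? c ]) * D * Δ
      ≡⟨ cong₂ (λ u v → u * D * Δ - v * D * Δ) ([≤]-[<] x b) ([≤]-[<] x c) ⟩
    [ b ℕ.≟ x ] * D * Δ - [ c ℕ.≟ x ] * D * Δ
      ≡⟨ sym (cong₂ _-_ (δ-by-sum b c r x y r′) (δ-swapped-by-sum b c r x y r′)) ⟩
    δ (b ∷ c ∷ r) (x ∷ y ∷ r′) - δ (b ∷ c ∷ r) (y ∷ x ∷ r′) ∎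
    where
    open ≡-Reasoning
    D Δ : ℤ
    D = [ x ℕ.+ y ℕ.≟ b ℕ.+ c ]
    Δ = δ r r′
    regroup : ∀ p q p′ q′ d z →
      (p - q) * d * z - (p′ - q′) * d * z ≡ (p - p′) * d * z - (q - q′) * d * z
    regroup = solve-∀

∂₁ᶜ-slice : ∀ {n} b c (r : Vec ℕ n) x e →
  ∂₁ᶜ b c r (x ∷ e) ≡ φ b c x * δ ((b ℕ.+ c ∸ suc x) ∷ r) e
∂₁ᶜ-slice b c r x (y ∷ r′) with suc x ℕ.≤? b ℕ.+ c
... | yes x<b+c = begin
  φ b c x * [ suc (x ℕ.+ y) ℕ.≟ b ℕ.+ c ] * δ r r′
    ≡⟨ cong (λ z → φ b c x * z * δ r r′)
       ([]-resp (suc (x ℕ.+ y) ℕ.≟ b ℕ.+ c) (b ℕ.+ c ∸ suc x ℕ.≟ y)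
         (λ eq → trans (cong (_∸ suc x) (sym eq)) (ℕP.m+n∸m≡n (suc x) y))
         (λ eq → trans (cong (suc x ℕ.+_) (sym eq)) (ℕP.m+[n∸m]≡n x<b+c))) ⟩
  φ b c x * [ b ℕ.+ c ∸ suc x ℕ.≟ y ] * δ r r′
    ≡⟨ ℤP.*-assoc (φ b c x) _ _ ⟩
  φ b c x * ([ b ℕ.+ c ∸ suc x ℕ.≟ y ] * δ r r′)
    ≡⟨ cong (φ b c x *_) (sym (δ-∷ (b ℕ.+ c ∸ suc x) r (y ∷ r′))) ⟩
  φ b c x * δ ((b ℕ.+ c ∸ suc x) ∷ r) (y ∷ r′) ∎
  where open ≡-Reasoning
... | no x≮b+c = trans (cong (λ z → z * [ suc (x ℕ.+ y) ℕ.≟ b ℕ.+ c ] * δ r r′) φ≡0)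
                       (sym (cong (_* δ ((b ℕ.+ c ∸ suc x) ∷ r) (y ∷ r′)) φ≡0))
  where
  φ≡0 : φ b c x ≡ 0ℤ
  φ≡0 = φ-vanish b c (ℕP.≮⇒≥ x≮b+c)

∂₁-terms : ∀ {n} → ℤ → ℕ → ℕ → Vec ℕ n → ℕ → Poly (suc (suc n))
∂₁-terms k b c r zero = []
∂₁-terms k b c r (suc t) = (k * φ b c t , t ∷ (b ℕ.+ c ∸ suc t) ∷ r) ∷ ∂₁-terms k b c r t

coeff-∂₁-terms : ∀ {n} k b c (r : Vec ℕ n) t x e →
  coeff (∂₁-terms k b c r t) (x ∷ e) ≡ [ x ℕ.<? t ] * (k * ∂₁ᶜ b c r (x ∷ e))
coeff-∂₁-terms k b c r zero x e = refl
coeff-∂₁-terms k b c r (suc t) x e = begin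
  coeff (∂₁-terms k b c r (suc t)) (x ∷ e)
    ≡⟨ coeff-∷ (k * φ b c t) _ (∂₁-terms k b c r t) (x ∷ e) ⟩
  k * φ b c t * δ (t ∷ (b ℕ.+ c ∸ suc t) ∷ r) (x ∷ e) + coeff (∂₁-terms k b c r t) (x ∷ e)
    ≡⟨ cong₂ _+_ (term-at t) (coeff-∂₁-terms k b c r t x e) ⟩
  [ t ℕ.≟ x ] * T x + [ x ℕ.<? t ] * T x
    ≡⟨ sym (ℤP.*-distribʳ-+ (T x) [ t ℕ.≟ x ] _) ⟩
  ([ t ℕ.≟ x ] + [ x ℕ.<? t ]) * T x
    ≡⟨ cong (_* T x) ([≟]+[<] t x) ⟩
  [ x ℕ.<? suc t ] * T x ∎
  where
  open ≡-Reasoning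
  T : ℕ → ℤ
  T x′ = k * ∂₁ᶜ b c r (x′ ∷ e)
  term-at : ∀ t → k * φ b c t * δ (t ∷ (b ℕ.+ c ∸ suc t) ∷ r) (x ∷ e) ≡ [ t ℕ.≟ x ] * T x
  term-at t = begin
    k * φ b c t * δ (t ∷ (b ℕ.+ c ∸ suc t) ∷ r) (x ∷ e)
      ≡⟨ cong (k * φ b c t *_) (δ-∷ t _ (x ∷ e)) ⟩
    k * φ b c t * ([ t ℕ.≟ x ] * δ ((b ℕ.+ c ∸ suc t) ∷ r) e)
      ≡⟨ reassoc k (φ b c t) [ t ℕ.≟ x ] _ ⟩
    [ t ℕ.≟ x ] * (k * (φ b c t * δ ((b ℕ.+ c ∸ suc t) ∷ r) e))
      ≡⟨ cong (λ z → [ t ℕ.≟ x ] * (k * z)) (sym (∂₁ᶜ-slice b c r t e)) ⟩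
    [ t ℕ.≟ x ] * T t
      ≡⟨ [≟]-subst (t ℕ.≟ x) T ⟩
    [ t ℕ.≟ x ] * T x ∎
    where
    reassoc : ∀ k f p d → k * f * (p * d) ≡ p * (k * (f * d))
    reassoc = solve-∀

∂₁-poly : ∀ {n} → ℤ → ℕ → ℕ → Vec ℕ n → Poly (suc (suc n))
∂₁-poly k b c r = ∂₁-terms k b c r (b ℕ.+ c)

coeff-∂₁-poly : ∀ {n} k b c (r : Vec ℕ n) → coeff (∂₁-poly k b c r) ≐ λ e → k * ∂₁ᶜ b c r e
coeff-∂₁-poly k b c r (x ∷ y ∷ r′) = trans (coeff-∂₁-terms k b c r (b ℕ.+ c) x (y ∷ r′))
  ([]-absorb (x ℕ.<? b ℕ.+ c) λ x≮b+c →
    trans (cong (λ z → k * (z * [ suc (x ℕ.+ y) ℕ.≟ b ℕ.+ c ] * δ r r′))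
                (φ-vanish b c (ℕP.≮⇒≥ x≮b+c)))
          (ℤP.*-zeroʳ k))

prefix : ∀ {n} → ℕ → Poly n → Poly (suc n)
prefix x [] = []
prefix x ((c , d) ∷ h) = (c , x ∷ d) ∷ prefix x h

coeff-prefix : ∀ {n} x (h : Poly n) → coeff (prefix x h) ≐ prefixᶜ x (coeff h)
coeff-prefix x [] (y ∷ e) = sym (ℤP.*-zeroʳ [ x ℕ.≟ y ])
coeff-prefix x ((c , d) ∷ h) (y ∷ e) = begin
  coeff ((c , x ∷ d) ∷ prefix x h) (y ∷ e)
    ≡⟨ coeff-∷ c (x ∷ d) (prefix x h) (y ∷ e) ⟩
  c * δ (x ∷ d) (y ∷ e) + coeff (prefix x h) (y ∷ e)
    ≡⟨ cong₂ (λ u v → c * u + v) (δ-∷ x d (y ∷ e)) (coeff-prefix x h (y ∷ e)) ⟩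
  c * ([ x ℕ.≟ y ] * δ d e) + [ x ℕ.≟ y ] * coeff h e
    ≡⟨ factor c [ x ℕ.≟ y ] (δ d e) (coeff h e) ⟩
  [ x ℕ.≟ y ] * (c * δ d e + coeff h e)
    ≡⟨ cong ([ x ℕ.≟ y ] *_) (sym (coeff-∷ c d h e)) ⟩
  [ x ℕ.≟ y ] * coeff ((c , d) ∷ h) e ∎
  where
  open ≡-Reasoning
  factor : ∀ c p a b → c * (p * a) + p * b ≡ p * (c * a + b)
  factor = solve-∀

divDiffMono : ∀ {n} → ℕ → ℤ → Vec ℕ n → Poly n
divDiffMono zero k [] = []
divDiffMono zero k (_ ∷ []) = []
divDiffMono zero k (b ∷ c ∷ r) = ∂₁-poly k b c r
divDiffMono (suc j) k [] = []
divDiffMono (suc j) k (x ∷ d) = prefix x (divDiffMono j k d)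

divDiffMono-isDivDiffᶜ : ∀ {n} j k (d : Vec ℕ n) →
  IsDivDiffᶜ j (λ e → k * δ d e) (coeff (divDiffMono j k d))
divDiffMono-isDivDiffᶜ zero k [] = IsDivDiffᶜ-swapInvariant zero _ λ { [] → refl }
divDiffMono-isDivDiffᶜ zero k (_ ∷ []) = IsDivDiffᶜ-swapInvariant zero _ λ { (_ ∷ []) → refl }
divDiffMono-isDivDiffᶜ zero k (b ∷ c ∷ r) =
  IsDivDiffᶜ-resp 0 (λ _ → refl) (λ e → sym (coeff-∂₁-poly k b c r e))
  (IsDivDiffᶜ-scale 0 k (∂₁ᶜ-isDivDiffᶜ b c r))
divDiffMono-isDivDiffᶜ (suc j) k [] = IsDivDiffᶜ-swapInvariant (suc j) _ λ { [] → refl }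
divDiffMono-isDivDiffᶜ (suc j) k (x ∷ d) = IsDivDiffᶜ-resp (suc j)
  (λ { (y ∷ e) → trans (swap-factors [ x ℕ.≟ y ] k (δ d e)) (cong (k *_) (sym (δ-∷ x d (y ∷ e)))) })
  (λ e → sym (coeff-prefix x (divDiffMono j k d) e))
  (IsDivDiffᶜ-prefix j x (divDiffMono-isDivDiffᶜ j k d))
  where
  swap-factors : ∀ p k a → p * (k * a) ≡ k * (p * a)
  swap-factors = solve-∀

divDiff : ∀ {n} → ℕ → Poly n → Poly n
divDiff j [] = []
divDiff j ((k , d) ∷ f) = divDiffMono j k d ++ divDiff j f

divDiff-isDivDiffᶜ : ∀ {n} j (f : Poly n) → IsDivDiffᶜ j (coeff f) (coeff (divDiff j f))
divDiff-isDivDiffᶜ j [] = IsDivDiffᶜ-0 j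
divDiff-isDivDiffᶜ j ((k , d) ∷ f) = IsDivDiffᶜ-resp j
  (λ e → sym (coeff-∷ k d f e)) (λ e → sym (coeff-++ (divDiffMono j k d) (divDiff j f) e))
  (IsDivDiffᶜ-+ j (divDiffMono-isDivDiffᶜ j k d) (divDiff-isDivDiffᶜ j f))

isDivDiff-divDiff : ∀ {n} j (f : Poly n) → IsDivDiff j f (divDiff j f)
isDivDiff-divDiff j f = IsDivDiffᶜ⇒IsDivDiff j f (divDiff j f) (divDiff-isDivDiffᶜ j f)

Chainᶜ : ∀ {n} → ℕ → Coeffs n → (ℕ → Coeffs n) → Set
Chainᶜ len F Gs = (Gs 0 ≐ F) × (∀ i → i < len → IsDivDiffᶜ i (Gs i) (Gs (suc i)))

IsDivDiffChain⇒Chainᶜ : ∀ {n} len (f : Poly n) (g : ℕ → Poly n) →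
  IsDivDiffChain len f g → Chainᶜ len (coeff f) (λ i → coeff (g i))
IsDivDiffChain⇒Chainᶜ len f g (g₀≈f , steps) =
  g₀≈f , λ i i<len → IsDivDiff⇒IsDivDiffᶜ i (g i) (g (suc i)) (steps i i<len)

Chainᶜ-zero : ∀ {n} len → len < n → {F : Coeffs n} {Gs : ℕ → Coeffs n} →
  Chainᶜ len F Gs → F ≐ 0ᶜ → Gs len ≐ 0ᶜ
Chainᶜ-zero len len<n {F} {Gs} (G₀≐F , steps) F≐0 = vanishes len ℕP.≤-refl
  where
  vanishes : ∀ i → i ≤ len → Gs i ≐ 0ᶜ
  vanishes zero _ e = trans (G₀≐F e) (F≐0 e)
  vanishes (suc i) i<len = IsDivDiffᶜ-unique i (ℕP.≤-<-trans i<len len<n)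
    (IsDivDiffᶜ-resp i (vanishes i (ℕP.<⇒≤ i<len)) (λ _ → refl) (steps i i<len)) (IsDivDiffᶜ-0 i)

Chainᶜ-slice : ∀ {n} len {F : Coeffs (suc n)} {Gs : ℕ → Coeffs (suc n)} x → Chainᶜ (suc len) F Gs →
  Chainᶜ len (λ e → Gs 1 (x ∷ e)) (λ i e → Gs (suc i) (x ∷ e))
Chainᶜ-slice len x (_ , steps) = (λ _ → refl) ,
  λ i i<len → isDivDiffᶜ λ e → mulDiff≐swapDiff (steps (suc i) (s≤s i<len)) (x ∷ e)

-- The main induction

m∸n≡o⇒m≡n+o : ∀ {m n o} → n ≤ m → m ∸ n ≡ o → m ≡ n ℕ.+ o
m∸n≡o⇒m≡n+o n≤m refl = sym (ℕP.m+[n∸m]≡n n≤m)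

+-≤-≡⇒≡ : ∀ {a a′ c c′} → a ≤ a′ → c ≤ c′ → a ℕ.+ c ≡ a′ ℕ.+ c′ → a ≡ a′ × c ≡ c′
+-≤-≡⇒≡ {a} {a′} {c} {c′} a≤a′ c≤c′ eq =
  a≡a′ , ℕP.+-cancelˡ-≡ a c c′ (trans eq (cong (ℕ._+ c′) (sym a≡a′)))
  where
  a≡a′ : a ≡ a′
  a≡a′ = ℕP.≤-antisym a≤a′ (ℕP.+-cancelʳ-≤ c′ a′ a
           (ℕP.≤-trans (ℕP.≤-reflexive (sym eq)) (ℕP.+-monoʳ-≤ a c≤c′)))

φ-cases : ∀ b c x →
  (x < b × c ≤ x × φ b c x ≡ 1ℤ) ⊎ (b ≤ x × x < c × φ b c x ≡ - 1ℤ) ⊎ φ b c x ≡ 0ℤ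
φ-cases b c x with x ℕ.<? b | x ℕ.<? c
... | yes _ | yes _ = inj₂ (inj₂ refl)
... | yes x<b | no x≮c = inj₁ (x<b , ℕP.≮⇒≥ x≮c , refl)
... | no x≮b | yes x<c = inj₂ (inj₁ (ℕP.≮⇒≥ x≮b , x<c , refl))
... | no _ | no _ = inj₂ (inj₂ refl)

φ≢0⇒∸≤ : ∀ {p} b c x → b ≤ suc p → c ≤ p → φ b c x ≢ 0ℤ → b ℕ.+ c ∸ suc x ≤ p
φ≢0⇒∸≤ {p} b c x b≤1+p c≤p φ≢0 with φ-cases b c x
... | inj₁ (_ , c≤x , _) = ℕP.m≤n+o⇒m∸n≤o (b ℕ.+ c) (suc x)
  (ℕP.≤-trans (ℕP.+-mono-≤ b≤1+p c≤x) (ℕP.≤-reflexive (cong suc (ℕP.+-comm p x))))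
... | inj₂ (inj₁ (b≤x , _ , _)) =
  ℕP.m≤n+o⇒m∸n≤o (b ℕ.+ c) (suc x) (ℕP.m≤n⇒m≤1+n (ℕP.+-mono-≤ b≤x c≤p))
... | inj₂ (inj₂ φ≡0) = contradiction φ≡0 φ≢0

φ-top-exponent : ∀ {p} b c x → b ≤ suc p → c ≤ p →
  φ b c x * [ b ℕ.+ c ∸ suc x ℕ.≟ p ] ≡ [ b ℕ.≟ suc p ] * [ c ℕ.≟ x ]
φ-top-exponent {p} b c x b≤1+p c≤p with φ-cases b c x
... | inj₁ (x<b , c≤x , φ≡1) = begin
  φ b c x * [ y₀ ℕ.≟ p ]   ≡⟨ cong (_* [ y₀ ℕ.≟ p ]) φ≡1 ⟩
  1ℤ * [ y₀ ℕ.≟ p ]        ≡⟨ ℤP.*-identityˡ _ ⟩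
  [ y₀ ℕ.≟ p ]
    ≡⟨ sym ([]-× (b ℕ.≟ suc p) (c ℕ.≟ x) (y₀ ℕ.≟ p) y₀≡p (proj₁ ∘ b≡∧c≡) (proj₂ ∘ b≡∧c≡)) ⟩
  [ b ℕ.≟ suc p ] * [ c ℕ.≟ x ] ∎
  where
  open ≡-Reasoning
  y₀ : ℕ
  y₀ = b ℕ.+ c ∸ suc x
  y₀≡p : b ≡ suc p → c ≡ x → y₀ ≡ p
  y₀≡p refl refl = ℕP.m+n∸n≡m p x
  b≡∧c≡ : y₀ ≡ p → b ≡ suc p × c ≡ x
  b≡∧c≡ y₀≡p = +-≤-≡⇒≡ b≤1+p c≤x
    (trans (m∸n≡o⇒m≡n+o (ℕP.≤-trans x<b (ℕP.m≤m+n b c)) y₀≡p) (cong suc (ℕP.+-comm x p)))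
... | inj₂ (inj₁ (b≤x , x<c , φ≡-1)) =
  trans (cong (_* [ y₀ ℕ.≟ p ]) φ≡-1) (trans (cong (- 1ℤ *_) ([]-no (y₀ ℕ.≟ p) y₀≢p))
    (sym (trans (cong ([ b ℕ.≟ suc p ] *_) ([]-no (c ℕ.≟ x) (ℕP.>⇒≢ x<c)))
                (ℤP.*-zeroʳ [ b ℕ.≟ suc p ]))))
  where
  y₀ : ℕ
  y₀ = b ℕ.+ c ∸ suc x
  y₀≢p : y₀ ≢ p
  y₀≢p y₀≡p = ℕP.≤⇒≯ (ℕP.+-mono-≤ b≤x c≤p)
    (ℕP.≤-reflexive (sym (m∸n≡o⇒m≡n+o (ℕP.≤-trans x<c (ℕP.m≤n+m c b)) y₀≡p)))
... | inj₂ (inj₂ φ≡0) = trans (cong (_* [ b ℕ.+ c ∸ suc x ℕ.≟ p ]) φ≡0)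
  (sym ([]-*-disjoint (b ℕ.≟ suc p) (c ℕ.≟ x)
    λ { refl refl → 1≢0 (trans (sym (φ≡1 (s≤s c≤p))) φ≡0) }))
  where
  φ≡1 : ∀ {b′ y} → y < b′ → φ b′ y y ≡ 1ℤ
  φ≡1 {b′} {y} y<b′ = cong₂ _-_ ([]-yes (y ℕ.<? b′) y<b′) ([]-no (y ℕ.<? y) (ℕP.n≮n y))
  1≢0 : 1ℤ ≢ 0ℤ
  1≢0 ()

Staircase : ∀ p → Vec ℕ p → Set
Staircase zero [] = ⊤
Staircase (suc p) (c ∷ r) = c ≤ p × Staircase p r

staircase : ∀ m (βt : Vec ℕ (suc m)) →
  ((j : Fin (suc m)) → lookup βt j ≤ m ∸ toℕ j) → Staircase (suc m) βt
staircase zero (c ∷ []) bounded = bounded Fin.zero , tt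
staircase (suc m) (c ∷ r) bounded = bounded Fin.zero , staircase m r (bounded ∘ Fin.suc)

-- The scalar k is needed because the a₁ˣ-parts start from k·φ b c x · a₂^{b+c−1−x} aʳ.
chain-top-monomial : ∀ p b (βt : Vec ℕ p) → Staircase p βt → b ≤ p → ∀ k {Gs : ℕ → Coeffs (suc p)} →
  Chainᶜ p (λ e → k * δ (b ∷ βt) e) Gs → Gs p ≐ λ e → k * [ b ℕ.≟ p ] * δ (βt ∷ʳ 0) e
chain-top-monomial zero zero [] _ z≤n k (G₀≐ , _) e =
  trans (G₀≐ e) (cong (_* δ (0 ∷ []) e) (sym (ℤP.*-identityʳ k)))
chain-top-monomial (suc p) b (c ∷ r) (c≤p , r-staircase) b≤1+p k {Gs} (G₀≐ , steps) (x ∷ e) = begin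
  Gs (suc p) (x ∷ e)
    ≡⟨ slice-top (φ b c x ℤP.≟ 0ℤ) ⟩
  k * φ b c x * [ y₀ ℕ.≟ p ] * δ (r ∷ʳ 0) e
    ≡⟨ cong (_* δ (r ∷ʳ 0) e)
         (trans (ℤP.*-assoc k (φ b c x) _) (cong (k *_) (φ-top-exponent b c x b≤1+p c≤p))) ⟩
  k * ([ b ℕ.≟ suc p ] * [ c ℕ.≟ x ]) * δ (r ∷ʳ 0) e
    ≡⟨ reassoc k [ b ℕ.≟ suc p ] [ c ℕ.≟ x ] (δ (r ∷ʳ 0) e) ⟩
  k * [ b ℕ.≟ suc p ] * ([ c ℕ.≟ x ] * δ (r ∷ʳ 0) e)
    ≡⟨ cong (k * [ b ℕ.≟ suc p ] *_) (sym (δ-∷ c (r ∷ʳ 0) (x ∷ e))) ⟩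
  k * [ b ℕ.≟ suc p ] * δ (c ∷ (r ∷ʳ 0)) (x ∷ e) ∎
  where
  open ≡-Reasoning
  y₀ : ℕ
  y₀ = b ℕ.+ c ∸ suc x
  reassoc : ∀ k u v d → k * (u * v) * d ≡ k * u * (v * d)
  reassoc = solve-∀
  G₁≐ : Gs 1 ≐ λ e → k * ∂₁ᶜ b c r e
  G₁≐ = IsDivDiffᶜ-unique 0 (s≤s (s≤s z≤n))
    (IsDivDiffᶜ-resp 0 G₀≐ (λ _ → refl) (steps 0 (s≤s z≤n)))
    (IsDivDiffᶜ-scale 0 k (∂₁ᶜ-isDivDiffᶜ b c r))
  Slice : Coeffs (suc p)
  Slice e = k * φ b c x * δ (y₀ ∷ r) e
  slice : Chainᶜ p Slice (λ i e → Gs (suc i) (x ∷ e))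
  slice = (λ e → trans (G₁≐ (x ∷ e))
                   (trans (cong (k *_) (∂₁ᶜ-slice b c r x e)) (sym (ℤP.*-assoc k _ _)))) ,
          proj₂ (Chainᶜ-slice p x (G₀≐ , steps))
  slice-top : Dec (φ b c x ≡ 0ℤ) → Gs (suc p) (x ∷ e) ≡ k * φ b c x * [ y₀ ℕ.≟ p ] * δ (r ∷ʳ 0) e
  slice-top (yes φ≡0) = trans (Chainᶜ-zero p (ℕP.n<1+n p) slice (λ e′ → cong (_* δ (y₀ ∷ r) e′) kφ≡0) e)
                              (sym (cong (λ z → z * [ y₀ ℕ.≟ p ] * δ (r ∷ʳ 0) e) kφ≡0))
    where
    kφ≡0 : k * φ b c x ≡ 0ℤ
    kφ≡0 = trans (cong (k *_) φ≡0) (ℤP.*-zeroʳ k)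
  slice-top (no φ≢0) =
    chain-top-monomial p y₀ r r-staircase (φ≢0⇒∸≤ b c x b≤1+p c≤p φ≢0) (k * φ b c x) slice e

divDiffs : ∀ {n} → Poly n → ℕ → Poly n
divDiffs f zero = f
divDiffs f (suc i) = divDiff i (divDiffs f i)

lemma6p4 : (m : ℕ) (b₁ : ℕ) (βt : Vec ℕ (suc m)) →
    ((j : Fin (suc m)) → lookup βt j ≤ m ∸ toℕ j) →
    (Σ (ℕ → Poly (suc (suc m))) (λ g → IsDivDiffChain (suc m) (mono (b₁ ∷ βt)) g))
    × ((g : ℕ → Poly (suc (suc m))) → IsDivDiffChain (suc m) (mono (b₁ ∷ βt)) g →
         (b₁ < suc m → g (suc m) ≈ 0P)
         × (b₁ ≡ suc m → g (suc m) ≈ mono (βt ∷ʳ 0)))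
lemma6p4 m b₁ βt bounded =
  (divDiffs (mono β) , (λ _ → refl) , λ i _ → isDivDiff-divDiff i (divDiffs (mono β) i)) ,
  λ g chain →
    (λ b₁<1+m e → trans (top (ℕP.<⇒≤ b₁<1+m) g chain e)
                    (cong (λ z → 1ℤ * z * δ (βt ∷ʳ 0) e) ([]-no (b₁ ℕ.≟ suc m) (ℕP.<⇒≢ b₁<1+m)))) ,
    (λ { refl e → trans (top ℕP.≤-refl g chain e)
                   (trans (cong (λ z → 1ℤ * z * δ (βt ∷ʳ 0) e) ([]-yes (suc m ℕ.≟ suc m) refl))
                     (trans (ℤP.*-identityˡ _) (sym (coeff-mono (βt ∷ʳ 0) e)))) })
  where
  β : Vec ℕ (suc (suc m))
  β = b₁ ∷ βt
  top : b₁ ≤ suc m → (g : ℕ → Poly (suc (suc m))) → IsDivDiffChain (suc m) (mono β) g →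
    coeff (g (suc m)) ≐ λ e → 1ℤ * [ b₁ ℕ.≟ suc m ] * δ (βt ∷ʳ 0) e
  top b₁≤1+m g chain =
    let (g₀≐ , steps) = IsDivDiffChain⇒Chainᶜ (suc m) (mono β) g chain in
    chain-top-monomial (suc m) b₁ βt (staircase m βt bounded) b₁≤1+m 1ℤ
      ((λ e → trans (g₀≐ e) (trans (coeff-mono β e) (sym (ℤP.*-identityˡ _)))) , steps)
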